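{- Let $a,b\in\mathfrak o$ with $a\mathfrak o+b\mathfrak o=\mathfrak o$. Then there exists $x\in\mathfrak o$ such that $a+xb$ is not divisible (in $\mathfrak o$) by any natural number $>1$.
   Context: $F=\mathbb Q(\sqrt d)$ is an imaginary quadratic field of discriminant $d<0$ and $\mathfrak o=\mathbb Z+\mathbb Z\omega$, $\omega=\frac{d+\sqrt d}{2}$, its ring of integers. -}

module Defs where

open import Data.Integer using (ℤ; +_; _+_; _*_; _-_; -_; _<_)
open import Data.Integer.Divisibility using (_∣_)
open import Data.Integer.DivMod using (_%ℕ_)
open import Data.Nat using (ℕ)
import Data.Nat as ℕ
open import Data.Product using (Σ; _×_; _,_; ∃)
open import Data.Sum using (_⊎_)
open import Relation.Binary.PropositionalEquality using (_≡_)
open import Relation.Nullary using (¬_)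

SquareFree : ℤ → Set
SquareFree m = ∀ (k : ℕ) → 1 ℕ.< k → ¬ ((+ (k ℕ.* k)) ∣ m)

IsFundamentalDiscriminant : ℤ → Set
IsFundamentalDiscriminant d =
  (d %ℕ 4 ≡ 1 × SquareFree d)
  ⊎ (Σ ℤ λ m → d ≡ + 4 * m × (m %ℕ 4 ≡ 2 ⊎ m %ℕ 4 ≡ 3) × SquareFree m)

-- Elements of 𝔬 = ℤ + ℤω, ω = (d + √d)/2; the pair (u , v) denotes u + v ω.
record 𝔬 : Set where
  constructor ⟨_,_⟩
  field
    re : ℤ
    om : ℤ
open 𝔬 public

-- ω² = d ω - (d² - d)/4 ; the integer (d² - d)/4, computed as (d*d - d) div 4
-- (exact for a discriminant, since d ≡ 0,1 mod 4).
open import Data.Integer.DivMod using (_/_)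

normω : ℤ → ℤ
normω d = (d * d - d) / (+ 4)

module Arith (d : ℤ) where
  infixl 6 _⊕_
  infixl 7 _⊗_
  _⊕_ : 𝔬 → 𝔬 → 𝔬
  ⟨ a , b ⟩ ⊕ ⟨ c , e ⟩ = ⟨ a + c , b + e ⟩

  _⊗_ : 𝔬 → 𝔬 → 𝔬
  ⟨ a , b ⟩ ⊗ ⟨ c , e ⟩ =
    ⟨ a * c - b * e * normω d , a * e + b * c + b * e * d ⟩

  ι : ℤ → 𝔬
  ι n = ⟨ n , + 0 ⟩

  one : 𝔬
  one = ι (+ 1)

  _∣𝔬_ : 𝔬 → 𝔬 → Set
  α ∣𝔬 β = Σ 𝔬 λ γ → β ≡ α ⊗ γ

  Comaximal : 𝔬 → 𝔬 → Set
  Comaximal a b = Σ 𝔬 λ u → Σ 𝔬 λ v → a ⊗ u ⊕ b ⊗ v ≡ one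

module Submission where

-- Take x = y ⊗ conj b, so that x ⊗ b = N(b) y and a + x b has coordinates
-- (a₁ + y₁ N(b), a₂ + y₂ N(b)); it suffices to make these two integers coprime.
-- Comaximality gives gcd(a₁, a₂, N(b)) = 1: if k divides a and N(b), then it divides
-- N(b v) = N(1 - a u) ≡ 1 (mod k).  Now pick y₂ with C = a₂ + y₂ N(b) ≠ 0 and, following
-- Bass, let t be the part of C coprime to a₁: a prime of C dividing a₁ divides neither
-- N(b) nor t, a prime of C not dividing a₁ divides t; either way it misses a₁ + t N(b).

open import Defs
open import Data.Integer using (ℤ; +_; _<_; _+_; _*_; _-_; -_; ∣_∣; 0ℤ; 1ℤ)
import Data.Integer.Properties as ℤ
open import Data.Integer.Coprimality using (Coprime; coprime-divisor)
open import Data.Integer.Divisibility.Signed as Signed using (divides; ∣ᵤ⇒∣; ∣⇒∣ᵤ)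
open import Data.Integer.GCD using (gcd)
open import Data.Integer.Tactic.RingSolver using (solve-∀)
open import Data.Nat using (ℕ)
import Data.Nat as ℕ
open import Data.Nat.Coprimality as ℕ using (gcd≡1⇒coprime)
open import Data.Nat.Divisibility as ℕ using (_∣_; ∣-refl; ∣-trans; ∣-reflexive; ∣1⇒≡1; *-pres-∣)
open import Data.Nat.GCD as ℕ using (gcd[m,n]∣m; gcd[m,n]∣n; gcd[m,n]≢0; gcd-greatest)
open import Data.Nat.Induction using (<-wellFounded)
import Data.Nat.Properties as ℕ
open import Data.Product using (Σ; _×_; ∃; ∃₂; _,_)
open import Data.Sum using (inj₁)
open import Function using (_∘_)
open import Induction.WellFounded using (Acc; acc)
open import Relation.Binary.PropositionalEquality
open import Relation.Nullary using (¬_; Dec; yes; no)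

coprime-divisor-^ : ∀ {k A r} m → ℕ.Coprime k A → k ∣ A ℕ.^ m ℕ.* r → k ∣ r
coprime-divisor-^ {k} {A} {r} ℕ.zero k⊥A k∣ = subst (k ∣_) (ℕ.*-identityˡ r) k∣
coprime-divisor-^ {k} {A} {r} (ℕ.suc m) k⊥A k∣ =
  coprime-divisor-^ m k⊥A (ℕ.coprime-divisor k⊥A (subst (k ∣_) (ℕ.*-assoc A _ r) k∣))

-- r is what is left of c after dividing out gcd c A for as long as it exceeds 1.
coprime-part : ∀ A c → c ≢ 0 → ∃₂ λ r m → ℕ.Coprime r A × c ∣ A ℕ.^ m ℕ.* r
coprime-part A c = go c (<-wellFounded c)
  where
  go : ∀ c → Acc ℕ._<_ c → c ≢ 0 → ∃₂ λ r m → ℕ.Coprime r A × c ∣ A ℕ.^ m ℕ.* r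
  go c (acc rec) c≢0 with ℕ.gcd c A ℕ.≟ 1 | gcd[m,n]∣m c A
  ... | yes g≡1 | _ = c , 0 , gcd≡1⇒coprime g≡1 , ∣-reflexive (sym (ℕ.*-identityˡ c))
  ... | no g≢1 | ℕ.divides c′ c≡c′g = lift (go c′ (rec c′<c) c′≢0)
    where
    g : ℕ
    g = ℕ.gcd c A
    c′≢0 : c′ ≢ 0
    c′≢0 refl = c≢0 c≡c′g
    1<g : 1 ℕ.< g
    1<g = ℕ.≤∧≢⇒< (ℕ.n≢0⇒n>0 (gcd[m,n]≢0 c A (inj₁ c≢0))) (g≢1 ∘ sym)
    c′<c : c′ ℕ.< c
    c′<c = subst (c′ ℕ.<_) (sym c≡c′g) (ℕ.m<m*n c′ g {{ℕ.≢-nonZero c′≢0}} 1<g)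
    lift : (∃₂ λ r m → ℕ.Coprime r A × c′ ∣ A ℕ.^ m ℕ.* r) →
           ∃₂ λ r m → ℕ.Coprime r A × c ∣ A ℕ.^ m ℕ.* r
    lift (r , m , r⊥A , c′∣Aᵐr) =
      r , ℕ.suc m , r⊥A ,
      subst₂ _∣_ (sym c≡c′g) (trans (ℕ.*-comm _ A) (sym (ℕ.*-assoc A _ r)))
        (*-pres-∣ c′∣Aᵐr (gcd[m,n]∣n c A))

coprime-shift : ∀ A B C → C ≢ 0ℤ → Coprime (gcd A B) C → ∃ λ t → Coprime (A + t * B) C
coprime-shift A B C C≢0 gcd⊥C
  with r , m , r⊥A , C∣Aᵐr ← coprime-part ∣ A ∣ ∣ C ∣ (C≢0 ∘ ℤ.∣i∣≡0⇒i≡0) = + r , A+rB⊥C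
  where
  A+rB⊥C : Coprime (A + + r * B) C
  A+rB⊥C {k} (k∣A+rB , k∣C) = k⊥r (∣-refl , coprime-divisor-^ m k⊥A (∣-trans k∣C C∣Aᵐr))
    where
    ∣k⇒∣A+rB : ∀ {q} → q ∣ k → + q Signed.∣ A + + r * B
    ∣k⇒∣A+rB {q} q∣k = Signed.∣-trans (∣ᵤ⇒∣ {+ q} {+ k} q∣k) (∣ᵤ⇒∣ k∣A+rB)
    k⊥r : ℕ.Coprime k r
    k⊥r {q} (q∣k , q∣r) =
      r⊥A (q∣r , ∣⇒∣ᵤ {+ q} {A}
        (Signed.∣m+n∣n⇒∣m (∣k⇒∣A+rB q∣k) (Signed.∣m⇒∣m*n B (∣ᵤ⇒∣ {+ q} {+ r} q∣r))))
    k⊥A : ℕ.Coprime k ∣ A ∣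
    k⊥A {q} (q∣k , q∣A) = gcd⊥C (gcd-greatest q∣A q∣B , ∣-trans q∣k k∣C)
      where
      q⊥r : ℕ.Coprime q r
      q⊥r (p∣q , p∣r) = k⊥r (∣-trans p∣q q∣k , p∣r)
      q∣B : q ∣ ∣ B ∣
      q∣B = coprime-divisor (+ q) (+ r) B q⊥r
              (∣⇒∣ᵤ (Signed.∣m+n∣m⇒∣n (∣k⇒∣A+rB q∣k) (∣ᵤ⇒∣ {+ q} {A} q∣A)))

gcd-coprime-shift : ∀ A₁ A₂ B y → Coprime (gcd A₁ A₂) B → Coprime (gcd A₁ B) (A₂ + y * B)
gcd-coprime-shift A₁ A₂ B y gcd⊥B {k} (k∣gcd , k∣A₂+yB) = gcd⊥B (gcd-greatest k∣A₁ k∣A₂ , k∣B)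
  where
  k∣A₁ : k ∣ ∣ A₁ ∣
  k∣A₁ = ∣-trans k∣gcd (gcd[m,n]∣m ∣ A₁ ∣ ∣ B ∣)
  k∣B : k ∣ ∣ B ∣
  k∣B = ∣-trans k∣gcd (gcd[m,n]∣n ∣ A₁ ∣ ∣ B ∣)
  k∣A₂ : k ∣ ∣ A₂ ∣
  k∣A₂ = ∣⇒∣ᵤ {+ k} {A₂}
    (Signed.∣m+n∣n⇒∣m (∣ᵤ⇒∣ k∣A₂+yB) (Signed.∣n⇒∣m*n y (∣ᵤ⇒∣ {+ k} {B} k∣B)))

unimodular-row-reduction : ∀ A₁ A₂ B → Coprime (gcd A₁ A₂) B →
                           ∃₂ λ y₁ y₂ → Coprime (A₁ + y₁ * B) (A₂ + y₂ * B)
unimodular-row-reduction A₁ A₂ B gcd⊥B = reduce (A₂ ℤ.≟ 0ℤ) (B ℤ.≟ 0ℤ)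
  where
  shift-by : ∀ y₂ → A₂ + y₂ * B ≢ 0ℤ → ∃₂ λ y₁ y₂ → Coprime (A₁ + y₁ * B) (A₂ + y₂ * B)
  shift-by y₂ C≢0
    with y₁ , cop ← coprime-shift A₁ B (A₂ + y₂ * B) C≢0 (gcd-coprime-shift A₁ A₂ B y₂ gcd⊥B)
    = y₁ , y₂ , cop
  reduce : Dec (A₂ ≡ 0ℤ) → Dec (B ≡ 0ℤ) → ∃₂ λ y₁ y₂ → Coprime (A₁ + y₁ * B) (A₂ + y₂ * B)
  reduce (no A₂≢0) _ = shift-by 0ℤ (A₂≢0 ∘ trans (sym (ℤ.+-identityʳ A₂)))
  reduce (yes refl) (no B≢0) =
    shift-by 1ℤ (B≢0 ∘ trans (sym (trans (ℤ.+-identityˡ _) (ℤ.*-identityˡ B))))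
  reduce (yes refl) (yes refl) = 0ℤ , 0ℤ , λ {k} (k∣A₁+0 , k∣0) →
    gcd⊥B (gcd-greatest (subst (k ∣_) (cong ∣_∣ (ℤ.+-identityʳ A₁)) k∣A₁+0) k∣0 , k∣0)

a+b≡c⇒b≡c-a : ∀ {a b c} → a + b ≡ c → b ≡ c - a
a+b≡c⇒b≡c-a {a} {b} refl = identity a b
  where
  identity : ∀ a b → b ≡ (a + b) - a
  identity = solve-∀

module Order (d : ℤ) where
  open Arith d

  infixl 7 _·_
  _·_ : 𝔬 → ℤ → 𝔬
  ⟨ u , v ⟩ · k = ⟨ u * k , v * k ⟩

  -- ω̄ = d - ω, so that ω + ω̄ = d and ω ω̄ = normω d.
  conj : 𝔬 → 𝔬
  conj ⟨ u , v ⟩ = ⟨ u + d * v , - v ⟩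

  trace : 𝔬 → ℤ
  trace ⟨ u , v ⟩ = u + u + d * v

  norm : 𝔬 → ℤ
  norm ⟨ u , v ⟩ = u * u + d * u * v + normω d * v * v

  ι-⊗ : ∀ k γ → ι k ⊗ γ ≡ γ · k
  ι-⊗ k ⟨ u , v ⟩ = cong₂ ⟨_,_⟩ (re-part k u v (normω d)) (om-part d k u v)
    where
    re-part : ∀ k u v N → k * u - + 0 * v * N ≡ u * k
    re-part = solve-∀
    om-part : ∀ d k u v → k * v + + 0 * u + + 0 * v * d ≡ v * k
    om-part = solve-∀

  ·-⊗ : ∀ k α β → α · k ⊗ β ≡ (α ⊗ β) · k
  ·-⊗ k ⟨ a , b ⟩ ⟨ c , e ⟩ = cong₂ ⟨_,_⟩ (re-part (normω d) k a b c e) (om-part d k a b c e)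
    where
    re-part : ∀ N k a b c e → a * k * c - b * k * e * N ≡ (a * c - b * e * N) * k
    re-part = solve-∀
    om-part : ∀ d k a b c e → a * k * e + b * k * c + b * k * e * d ≡ (a * e + b * c + b * e * d) * k
    om-part = solve-∀

  ⊗-conj-⊗ : ∀ y b → y ⊗ conj b ⊗ b ≡ y · norm b
  ⊗-conj-⊗ ⟨ y₁ , y₂ ⟩ ⟨ b₁ , b₂ ⟩ =
    cong₂ ⟨_,_⟩ (re-part d (normω d) y₁ y₂ b₁ b₂) (om-part d (normω d) y₁ y₂ b₁ b₂)
    where
    re-part : ∀ d N y₁ y₂ b₁ b₂ →
      let c₁ = y₁ * (b₁ + d * b₂) - y₂ * (- b₂) * N
          c₂ = y₁ * (- b₂) + y₂ * (b₁ + d * b₂) + y₂ * (- b₂) * d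
      in c₁ * b₁ - c₂ * b₂ * N ≡ y₁ * (b₁ * b₁ + d * b₁ * b₂ + N * b₂ * b₂)
    re-part = solve-∀
    om-part : ∀ d N y₁ y₂ b₁ b₂ →
      let c₁ = y₁ * (b₁ + d * b₂) - y₂ * (- b₂) * N
          c₂ = y₁ * (- b₂) + y₂ * (b₁ + d * b₂) + y₂ * (- b₂) * d
      in c₁ * b₂ + c₂ * b₁ + c₂ * b₂ * d ≡ y₂ * (b₁ * b₁ + d * b₁ * b₂ + N * b₂ * b₂)
    om-part = solve-∀

  norm-⊗ : ∀ α β → norm (α ⊗ β) ≡ norm α * norm β
  norm-⊗ ⟨ a , b ⟩ ⟨ c , e ⟩ = identity d (normω d) a b c e
    where
    identity : ∀ d N a b c e → let q = λ x y → x * x + d * x * y + N * y * y in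
      q (a * c - b * e * N) (a * e + b * c + b * e * d) ≡ q a b * q c e
    identity = solve-∀

  norm-complement : ∀ k α β → α · k ⊕ β ≡ one → norm β + k * (trace α - norm α * k) ≡ 1ℤ
  norm-complement k ⟨ u , v ⟩ ⟨ x , y ⟩ α+β≡1
    with refl ← a+b≡c⇒b≡c-a {u * k} {x} (cong re α+β≡1)
       | refl ← a+b≡c⇒b≡c-a {v * k} {y} (cong om α+β≡1)
    = identity d (normω d) k u v
    where
    identity : ∀ d N k u v → let q = λ x y → x * x + d * x * y + N * y * y in
      q (+ 1 - u * k) (+ 0 - v * k) + k * (u + u + d * v - q u v * k) ≡ + 1
    identity = solve-∀

  Primitive : 𝔬 → Set
  Primitive α = ∀ n → 1 ℕ.< n → ¬ ι (+ n) ∣𝔬 α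

  coprime⇒primitive : ∀ {u v} → Coprime u v → Primitive ⟨ u , v ⟩
  coprime⇒primitive {u} {v} u⊥v n 1<n (γ , uv≡nγ) =
    ℕ.<⇒≢ 1<n (sym (u⊥v (∣⇒∣ᵤ {+ n} {u} (divides (re γ) (cong re uv≡γn)) ,
                          ∣⇒∣ᵤ {+ n} {v} (divides (om γ) (cong om uv≡γn)))))
    where
    uv≡γn : ⟨ u , v ⟩ ≡ γ · + n
    uv≡γn = trans uv≡nγ (ι-⊗ (+ n) γ)

  comaximal⇒coprime : ∀ a b → Comaximal a b → Coprime (gcd (re a) (om a)) (norm b)
  comaximal⇒coprime ⟨ a₁ , a₂ ⟩ b (u , v , au+bv≡1) {k} (k∣gcd , k∣Nb)
    with divides P refl ← ∣ᵤ⇒∣ {+ k} {a₁} (∣-trans k∣gcd (gcd[m,n]∣m ∣ a₁ ∣ ∣ a₂ ∣))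
       | divides Q refl ← ∣ᵤ⇒∣ {+ k} {a₂} (∣-trans k∣gcd (gcd[m,n]∣n ∣ a₁ ∣ ∣ a₂ ∣))
    = ∣1⇒≡1 (∣⇒∣ᵤ {+ k} {1ℤ} k∣1)
    where
    α : 𝔬
    α = ⟨ P , Q ⟩ ⊗ u
    complement : α · + k ⊕ b ⊗ v ≡ one
    complement = trans (cong (_⊕ b ⊗ v) (sym (·-⊗ (+ k) ⟨ P , Q ⟩ u))) au+bv≡1
    k∣N[bv] : + k Signed.∣ norm (b ⊗ v)
    k∣N[bv] = subst (+ k Signed.∣_) (sym (norm-⊗ b v))
                (Signed.∣m⇒∣m*n (norm v) (∣ᵤ⇒∣ {+ k} {norm b} k∣Nb))
    k∣1 : + k Signed.∣ 1ℤ
    k∣1 = subst (+ k Signed.∣_) (norm-complement (+ k) α (b ⊗ v) complement)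
            (Signed.∣m∣n⇒∣m+n k∣N[bv] (Signed.∣m⇒∣m*n _ (Signed.∣-refl {+ k})))

  primitive-translate : ∀ a b → Comaximal a b → Σ 𝔬 λ x → Primitive (a ⊕ x ⊗ b)
  primitive-translate a@(⟨ a₁ , a₂ ⟩) b a⊥b
    with y₁ , y₂ , coprime ← unimodular-row-reduction a₁ a₂ (norm b) (comaximal⇒coprime a b a⊥b)
    = y ⊗ conj b
    , subst Primitive (cong (a ⊕_) (sym (⊗-conj-⊗ y b))) (coprime⇒primitive coprime)
    where
    y : 𝔬
    y = ⟨ y₁ , y₂ ⟩

lemma5p5 : (d : ℤ) → d < + 0 → IsFundamentalDiscriminant d →
    let open Arith d in
    (a b : 𝔬) → Comaximal a b →
    Σ 𝔬 λ x → ∀ (n : ℕ) → 1 ℕ.< n → ¬ (ι (+ n) ∣𝔬 (a ⊕ x ⊗ b))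
lemma5p5 d _ _ = primitive-translate
  where open Order d
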